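{- Let $b\ge 2$ and $k\ge 1$ be integers. Let $m\ge 1$ be an integer with $\gcd(m,b)=1$, and let $r$ be an integer with $0\le r<m$. Then there exist infinitely many positive integers $n$ with $n\equiv r\pmod m$ that are $b^\ell$-Niven for every $\ell$ with $1\le \ell\le k$. Moreover, for every $s_0\ge 1$ there exists such an $n$ with \[ \mathsf{s}_b(n)=\mathsf{s}_{b^2}(n)=\cdots=\mathsf{s}_{b^k}(n)\ge s_0. \]
   Context: For an integer base $g\ge 2$ and a positive integer $c$ with base-$g$ expansion $c=\sum_{i=0}^{L} d_i g^i$, $d_i\in\{0,1,\dots,g-1\}$, $d_L\neq 0$, the base-$g$ digit sum is $\mathsf{s}_g(c)=\sum_{i=0}^{L} d_i$. An integer $c$ is called $g$-Niven if $\mathsf{s}_g(c)\mid c$. -}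

module Defs where

open import Data.Nat using (ℕ; zero; suc; _+_; _*_; _^_; _<_; _≤_; NonZero)
open import Data.Nat.DivMod using (_/_; _%_)
open import Data.Nat.Divisibility using (_∣_)
open import Data.Nat.GCD using (gcd)
open import Data.Product using (_×_; ∃-syntax)
open import Relation.Binary.PropositionalEquality using (_≡_)

-- Base-g digit sum with a fuel argument (fuel ≥ number of digits suffices;
-- fuel = c always suffices for g ≥ 2).  For base g = suc (suc h) ≥ 2.
digitSumFuel : ℕ → (g : ℕ) → .{{NonZero g}} → ℕ → ℕ
digitSumFuel zero    g c = 0
digitSumFuel (suc f) g zero = 0
digitSumFuel (suc f) g c@(suc _) = c % g + digitSumFuel f g (c / g)

s : (g : ℕ) → .{{NonZero g}} → ℕ → ℕ
s g c = digitSumFuel c g c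

Niven : (g : ℕ) → .{{NonZero g}} → ℕ → Set
Niven g c = s g c ∣ c

open import Data.Nat using (s≤s; z≤n)
open import Data.Nat.Properties using (m^n≢0)

pow-nz : {b : ℕ} → 2 ≤ b → (l : ℕ) → NonZero (b ^ l)
pow-nz {suc b'} (s≤s _) l = m^n≢0 (suc b') l

-- Pick t as large as required, with t ≡ r (mod m) and gcd(t, b) = 1, and an
-- exponent E with b^E ≡ 1 (mod m t) and l ∣ E for all l ≤ k.  The base-b^E
-- repunit n = 1 + b^E + ⋯ + b^((t-1)E) has t digits equal to 1 in every base
-- b^l, so s_{b^l}(n) = t; and n ≡ t (mod m t), whence t ∣ n and n ≡ r (mod m).
module Submission where

open import Defs
open import Data.Nat
open import Data.Nat.Properties
open import Data.Nat.DivMod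
open import Data.Nat.Divisibility
open import Data.Nat.GCD using (gcd)
open import Data.Nat.Coprimality using (Coprime; coprime-divisor; gcd≡1⇒coprime)
open import Data.Nat.Solver using (module +-*-Solver)
open import Data.Fin using (toℕ; fromℕ<)
open import Data.Fin.Properties using (pigeonhole; toℕ-fromℕ<)
open import Data.Product using (_×_; _,_; ∃-syntax)
open import Data.Empty using (⊥-elim)
open import Relation.Binary.PropositionalEquality
  using (_≡_; refl; sym; trans; cong; cong₂; subst; module ≡-Reasoning)
open +-*-Solver using (solve; _:+_; _:*_; _:=_; con)

repunit : ℕ → ℕ → ℕ
repunit R zero    = 0
repunit R (suc i) = 1 + R * repunit R i

module DigitSum (G : ℕ) .{{_ : NonZero G}} (2≤G : 2 ≤ G) where

  open ≡-Reasoning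

  digitSumFuel-0 : ∀ f → digitSumFuel f G 0 ≡ 0
  digitSumFuel-0 zero    = refl
  digitSumFuel-0 (suc f) = refl

  suc-c/G≤c : ∀ c → suc c / G ≤ c
  suc-c/G≤c c = ≤-pred (m/n<m (suc c) G 2≤G)

  digitSumFuel-irrelevant : ∀ f f' c → c ≤ f → c ≤ f' →
                            digitSumFuel f G c ≡ digitSumFuel f' G c
  digitSumFuel-irrelevant f f' zero _ _ = trans (digitSumFuel-0 f) (sym (digitSumFuel-0 f'))
  digitSumFuel-irrelevant (suc f) (suc f') (suc c) (s≤s c≤f) (s≤s c≤f') =
    cong (suc c % G +_) (digitSumFuel-irrelevant f f' (suc c / G)
      (≤-trans (suc-c/G≤c c) c≤f) (≤-trans (suc-c/G≤c c) c≤f'))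

  s-unfold : ∀ c → s G c ≡ c % G + s G (c / G)
  s-unfold zero    = sym (cong₂ _+_ (m*n%n≡0 0 G) (cong (s G) (0/n≡0 G)))
  s-unfold (suc c) = cong (suc c % G +_)
    (digitSumFuel-irrelevant c (suc c / G) (suc c / G) (suc-c/G≤c c) ≤-refl)

  s-digit+ : ∀ d x → d < G → s G (d + x * G) ≡ d + s G x
  s-digit+ d x d<G = begin
    s G (d + x * G)                         ≡⟨ s-unfold (d + x * G) ⟩
    (d + x * G) % G + s G ((d + x * G) / G) ≡⟨ cong₂ _+_ last-digit (cong (s G) leading-digits) ⟩
    d + s G x                               ∎
    where
    last-digit : (d + x * G) % G ≡ d
    last-digit = trans ([m+kn]%n≡m%n d x G) (m<n⇒m%n≡m d<G)
    leading-digits : (d + x * G) / G ≡ x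
    leading-digits = begin
      (d + x * G) / G   ≡⟨ +-distrib-/-∣ʳ d (n∣m*n x) ⟩
      d / G + x * G / G ≡⟨ cong₂ _+_ (m<n⇒m/n≡0 d<G) (m*n/n≡m x G) ⟩
      x                 ∎

  G^[1+Q]*y≡G^Q*y*G : ∀ Q y → G ^ suc Q * y ≡ G ^ Q * y * G
  G^[1+Q]*y≡G^Q*y*G Q y = trans (*-assoc G (G ^ Q) y) (*-comm G (G ^ Q * y))

  s-G^Q* : ∀ Q y → s G (G ^ Q * y) ≡ s G y
  s-G^Q* zero    y = cong (s G) (+-identityʳ y)
  s-G^Q* (suc Q) y = begin
    s G (G ^ suc Q * y)     ≡⟨ cong (s G) (G^[1+Q]*y≡G^Q*y*G Q y) ⟩
    s G (0 + G ^ Q * y * G) ≡⟨ s-digit+ 0 (G ^ Q * y) (≤-trans (s≤s z≤n) 2≤G) ⟩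
    s G (G ^ Q * y)         ≡⟨ s-G^Q* Q y ⟩
    s G y                   ∎

  s-1+G^[1+Q]* : ∀ Q y → s G (1 + G ^ suc Q * y) ≡ 1 + s G y
  s-1+G^[1+Q]* Q y = begin
    s G (1 + G ^ suc Q * y)   ≡⟨ cong (λ z → s G (1 + z)) (G^[1+Q]*y≡G^Q*y*G Q y) ⟩
    s G (1 + G ^ Q * y * G)   ≡⟨ s-digit+ 1 (G ^ Q * y) 2≤G ⟩
    1 + s G (G ^ Q * y)       ≡⟨ cong (1 +_) (s-G^Q* Q y) ⟩
    1 + s G y                 ∎

  s-repunit : ∀ Q i → s G (repunit (G ^ suc Q) i) ≡ i
  s-repunit Q zero    = refl
  s-repunit Q (suc i) = trans (s-1+G^[1+Q]* Q (repunit (G ^ suc Q) i)) (cong suc (s-repunit Q i))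

coprime-1+m*n : ∀ m n → Coprime (1 + m * n) m
coprime-1+m*n m n {d} (d∣1+mn , d∣m) =
  ∣1⇒≡1 (∣m+n∣m⇒∣n (subst (d ∣_) (+-comm 1 (m * n)) d∣1+mn) (∣-trans d∣m (m∣m*n n)))

coprime-*ˡ : ∀ {m n o} → Coprime m o → Coprime n o → Coprime (m * n) o
coprime-*ˡ {m} cm cn {d} (d∣mn , d∣o) = cn (coprime-divisor d⊥m d∣mn , d∣o)
  where
  d⊥m : Coprime d m
  d⊥m (i∣d , i∣m) = cm (i∣m , ∣-trans i∣d d∣o)

coprime-^-divisor : ∀ {m b} → Coprime m b → ∀ a {x} → m ∣ b ^ a * x → m ∣ x
coprime-^-divisor {m} m⊥b zero    {x} m∣x = subst (m ∣_) (+-identityʳ x) m∣x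
coprime-^-divisor {m} {b} m⊥b (suc a) {x} m∣b^[1+a]x =
  coprime-^-divisor m⊥b a (coprime-divisor m⊥b (subst (m ∣_) (*-assoc b (b ^ a) x) m∣b^[1+a]x))

%-≡⇒∣∸ : ∀ m n d .{{_ : NonZero d}} → m % d ≡ n % d → d ∣ m ∸ n
%-≡⇒∣∸ m n d eq = divides (m / d ∸ n / d) (begin
  m ∸ n                                   ≡⟨ cong₂ _∸_ (m≡m%n+[m/n]*n m d)
                                               (trans (m≡m%n+[m/n]*n n d) (cong (_+ n / d * d) (sym eq))) ⟩
  (m % d + m / d * d) ∸ (m % d + n / d * d) ≡⟨ [m+n]∸[m+o]≡n∸o (m % d) _ _ ⟩
  m / d * d ∸ n / d * d                   ≡⟨ *-distribʳ-∸ d (m / d) (n / d) ⟨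
  (m / d ∸ n / d) * d                     ∎)
  where open ≡-Reasoning

m∣n∸1⇒n≡1+m* : ∀ {m n} → 1 ≤ n → m ∣ n ∸ 1 → ∃[ q ] (n ≡ 1 + m * q)
m∣n∸1⇒n≡1+m* {m} 1≤n (divides q n∸1≡qm) =
  q , trans (sym (m+[n∸m]≡n 1≤n)) (cong (1 +_) (trans n∸1≡qm (*-comm q m)))

-- Pigeonhole on b^0, …, b^m modulo m gives b^a ≡ b^(a+1+e) (mod m); cancel b^a.
^≡1+m* : ∀ m b .{{_ : NonZero m}} .{{_ : NonZero b}} → Coprime m b →
         ∃[ e ] ∃[ q ] (b ^ suc e ≡ 1 + m * q)
^≡1+m* m b m⊥b with pigeonhole (n<1+n m) (λ i → fromℕ< (m%n<n (b ^ toℕ i) m))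
... | i , j , i<j , same = e , m∣n∸1⇒n≡1+m* (m^n>0 b (suc e)) m∣b^[1+e]∸1
  where
  open ≡-Reasoning
  a = toℕ i
  e = toℕ j ∸ suc a
  same-residue : b ^ toℕ j % m ≡ b ^ a % m
  same-residue = trans (sym (toℕ-fromℕ< _)) (trans (cong toℕ (sym same)) (toℕ-fromℕ< _))
  b^j∸b^a≡b^a*[b^[1+e]∸1] : b ^ toℕ j ∸ b ^ a ≡ b ^ a * (b ^ suc e ∸ 1)
  b^j∸b^a≡b^a*[b^[1+e]∸1] = begin
    b ^ toℕ j ∸ b ^ a             ≡⟨ cong (λ x → b ^ x ∸ b ^ a) (trans (+-suc a e) (m+[n∸m]≡n i<j)) ⟨
    b ^ (a + suc e) ∸ b ^ a       ≡⟨ cong₂ _∸_ (^-distribˡ-+-* b a (suc e)) (sym (*-identityʳ (b ^ a))) ⟩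
    b ^ a * b ^ suc e ∸ b ^ a * 1 ≡⟨ *-distribˡ-∸ (b ^ a) (b ^ suc e) 1 ⟨
    b ^ a * (b ^ suc e ∸ 1)       ∎
  m∣b^[1+e]∸1 : m ∣ b ^ suc e ∸ 1
  m∣b^[1+e]∸1 = coprime-^-divisor m⊥b a
    (subst (m ∣_) b^j∸b^a≡b^a*[b^[1+e]∸1] (%-≡⇒∣∸ _ _ m same-residue))

[1+m*q]^≡1+m* : ∀ m q j → ∃[ q' ] ((1 + m * q) ^ j ≡ 1 + m * q')
[1+m*q]^≡1+m* m q zero    = 0 , cong suc (sym (*-zeroʳ m))
[1+m*q]^≡1+m* m q (suc j) with [1+m*q]^≡1+m* m q j
... | q' , eq = q + q' + m * q * q' , trans (cong ((1 + m * q) *_) eq)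
  (solve 3 (λ m q q' → (con 1 :+ m :* q) :* (con 1 :+ m :* q')
                     := con 1 :+ m :* (q :+ q' :+ m :* q :* q')) refl m q q')

repunit[1+m*q]≡+m* : ∀ m q i → ∃[ g ] (repunit (1 + m * q) i ≡ i + m * g)
repunit[1+m*q]≡+m* m q zero    = 0 , sym (*-zeroʳ m)
repunit[1+m*q]≡+m* m q (suc i) with repunit[1+m*q]≡+m* m q i
... | g , eq = g + q * i + m * q * g , trans (cong (λ x → 1 + (1 + m * q) * x) eq)
  (solve 4 (λ m q i g → con 1 :+ (con 1 :+ m :* q) :* (i :+ m :* g)
                      := (con 1 :+ i) :+ m :* (g :+ q :* i :+ m :* q :* g)) refl m q i g)

∣! : ∀ {l k} → 1 ≤ l → l ≤ k → l ∣ k !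
∣! {suc l} _ l≤k = ∣-trans (m∣m*n (l !)) (m≤n⇒m!∣n! l≤k)

2≤^ : ∀ b l → 2 ≤ b → 1 ≤ l → 2 ≤ b ^ l
2≤^ b@(suc (suc _)) (suc l) 2≤b _ = *-mono-≤ 2≤b (m^n>0 b l)
2≤^ (suc zero)      (suc l) (s≤s ()) _

DigitSums≡ : (b : ℕ) → 2 ≤ b → (k n t : ℕ) → Set
DigitSums≡ b hb k n t = (l : ℕ) → 1 ≤ l → l ≤ k → s (b ^ l) {{pow-nz hb l}} n ≡ t

-- Every l ≤ k divides k!, so b^((1+e) k!) is a positive power of b^l.
s-repunit-^! : ∀ b (hb : 2 ≤ b) k e t → DigitSums≡ b hb k (repunit ((b ^ suc e) ^ (k !)) t) t
s-repunit-^! b hb k e t l 1≤l l≤k with ∣! 1≤l l≤k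
... | divides zero    k!≡0       = ⊥-elim (≢-nonZero⁻¹ (k !) {{k !≢0}} k!≡0)
... | divides (suc u) k!≡[1+u]*l =
  trans (cong (λ R → s (b ^ l) {{pow-nz hb l}} (repunit R t)) power-of-b^l)
        (DigitSum.s-repunit (b ^ l) {{pow-nz hb l}} (2≤^ b l hb 1≤l) (u + e * suc u) t)
  where
  open ≡-Reasoning
  power-of-b^l : (b ^ suc e) ^ (k !) ≡ (b ^ l) ^ (suc e * suc u)
  power-of-b^l = begin
    (b ^ suc e) ^ (k !)          ≡⟨ ^-*-assoc b (suc e) (k !) ⟩
    b ^ (suc e * k !)            ≡⟨ cong (λ x → b ^ (suc e * x)) k!≡[1+u]*l ⟩
    b ^ (suc e * (suc u * l))    ≡⟨ cong (b ^_) (solve 3 (λ e u l → e :* (u :* l) := l :* (e :* u)) refl (suc e) (suc u) l) ⟩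
    b ^ (l * (suc e * suc u))    ≡⟨ ^-*-assoc b l (suc e * suc u) ⟨
    (b ^ l) ^ (suc e * suc u)    ∎

repunit-with-digitSums : ∀ b k m t (hb : 2 ≤ b) .{{_ : NonZero (m * t)}} → Coprime (m * t) b →
                         ∃[ n ] ∃[ g ] (n ≡ t + m * t * g × DigitSums≡ b hb k n t)
repunit-with-digitSums b k m t hb {{mt≢0}} mt⊥b =
  let e , q , b^[1+e]≡ = ^≡1+m* (m * t) b {{mt≢0}} {{>-nonZero (≤-trans (s≤s z≤n) hb)}} mt⊥b
      q' , R≡          = [1+m*q]^≡1+m* (m * t) q (k !)
      g , n≡           = repunit[1+m*q]≡+m* (m * t) q' t
  in  repunit ((b ^ suc e) ^ (k !)) t , g
    , trans (cong (λ R → repunit R t) (trans (cong (_^ (k !)) b^[1+e]≡) R≡)) n≡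
    , s-repunit-^! b hb k e t

-- With b·b^e ≡ 1 (mod m), t = 1 + b(b^e(r + m - 1) + m X) ≡ r (mod m).
coprime-representative : ∀ b m r X .{{_ : NonZero b}} .{{_ : NonZero m}} → Coprime m b → r < m →
                         ∃[ t ] (X < t × t % m ≡ r × Coprime t b)
coprime-representative b m r X m⊥b r<m with ^≡1+m* m b m⊥b
... | e , q , b^[1+e]≡ = 1 + b * z , X<t , t%m≡r , coprime-1+m*n b z
  where
  open ≡-Reasoning
  c = r + pred m
  z = b ^ e * c + m * X
  Y = q * c + b * X
  t≡r+[1+Y]*m : 1 + b * z ≡ r + (1 + Y) * m
  t≡r+[1+Y]*m = begin
    1 + b * (b ^ e * c + m * X)           ≡⟨ cong suc (solve 5 (λ b w c m X → b :* (w :* c :+ m :* X)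
                                               := b :* w :* c :+ m :* (b :* X)) refl b (b ^ e) c m X) ⟩
    1 + (b ^ suc e * c + m * (b * X))     ≡⟨ cong (λ x → 1 + (x * c + m * (b * X))) b^[1+e]≡ ⟩
    1 + ((1 + m * q) * c + m * (b * X))   ≡⟨ cong suc (solve 5 (λ m q c b X → (con 1 :+ m :* q) :* c :+ m :* (b :* X)
                                               := c :+ m :* (q :* c :+ b :* X)) refl m q c b X) ⟩
    1 + c + m * Y                         ≡⟨ cong (_+ m * Y) (trans (sym (+-suc r (pred m))) (cong (r +_) (suc-pred m))) ⟩
    r + m + m * Y                         ≡⟨ solve 3 (λ r m Y → r :+ m :+ m :* Y := r :+ (con 1 :+ Y) :* m) refl r m Y ⟩
    r + (1 + Y) * m                       ∎
  t%m≡r : (1 + b * z) % m ≡ r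
  t%m≡r = trans (cong (_% m) t≡r+[1+Y]*m) (trans ([m+kn]%n≡m%n r (1 + Y) m) (m<n⇒m%n≡m r<m))
  X<t : X < 1 + b * z
  X<t = s≤s (≤-trans (m≤n*m X m) (≤-trans (m≤n+m (m * X) (b ^ e * c)) (m≤n*m z b)))

DigitSums≡⇒Niven : ∀ b (hb : 2 ≤ b) k {n t} → DigitSums≡ b hb k n t → t ∣ n →
                   (l : ℕ) → 1 ≤ l → l ≤ k → Niven (b ^ l) {{pow-nz hb l}} n
DigitSums≡⇒Niven b hb k {n} sums t∣n l 1≤l l≤k = subst (_∣ n) (sym (sums l 1≤l l≤k)) t∣n

t+m*t*g-properties : ∀ {n t m} g .{{_ : NonZero m}} → n ≡ t + m * t * g → t ≤ n × n % m ≡ t % m × t ∣ n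
t+m*t*g-properties {n} {t} {m} g n≡ rewrite n≡ =
  m≤m+n t (m * t * g) , %-remove-+ʳ t (∣-trans (m∣m*n t) (m∣m*n g)) , ∣m∣n⇒∣m+n ∣-refl (n∣m*n*o m g)

Niven-with-large-digitSum : ∀ b k m r (hb : 2 ≤ b) .{{_ : NonZero m}} → Coprime m b → r < m → ∀ X →
  ∃[ n ] ∃[ t ] (X < t × t ≤ n × n % m ≡ r × t ∣ n × DigitSums≡ b hb k n t)
Niven-with-large-digitSum b k m r hb {{m≢0}} m⊥b r<m X =
  let t , X<t , t%m≡r , t⊥b = coprime-representative b m r X {{>-nonZero (≤-trans (s≤s z≤n) hb)}} m⊥b r<m
      n , g , n≡ , sums     = repunit-with-digitSums b k m t hb {{m*n≢0 m t {{m≢0}} {{>-nonZero (≤-trans (s≤s z≤n) X<t)}}}}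
                                (coprime-*ˡ m⊥b t⊥b)
      t≤n , n%m≡t%m , t∣n   = t+m*t*g-properties g n≡
  in  n , t , X<t , t≤n , trans n%m≡t%m t%m≡r , t∣n , sums

corollary7p1 : (b k m r : ℕ) → (hb : 2 ≤ b) → 1 ≤ k → .{{_ : NonZero m}} → gcd m b ≡ 1 → r < m →
    ((N : ℕ) → ∃[ n ] (N < n × n % m ≡ r
    × ((l : ℕ) → 1 ≤ l → l ≤ k → Niven (b ^ l) {{pow-nz hb l}} n)))
    × ((s₀ : ℕ) → 1 ≤ s₀ → ∃[ n ] (1 ≤ n × n % m ≡ r
    × ((l : ℕ) → 1 ≤ l → l ≤ k → Niven (b ^ l) {{pow-nz hb l}} n)
    × ((l : ℕ) → 1 ≤ l → l ≤ k → s (b ^ l) {{pow-nz hb l}} n ≡ s (b ^ 1) {{pow-nz hb 1}} n)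
    × s₀ ≤ s (b ^ 1) {{pow-nz hb 1}} n))
corollary7p1 b k m r hb 1≤k gcd≡1 r<m =
    (λ N → let n , t , N<t , t≤n , n%m≡r , t∣n , sums = Niven-with-large-digitSum b k m r hb m⊥b r<m N
           in  n , <-≤-trans N<t t≤n , n%m≡r , DigitSums≡⇒Niven b hb k sums t∣n)
  , (λ s₀ _ → let n , t , s₀<t , t≤n , n%m≡r , t∣n , sums = Niven-with-large-digitSum b k m r hb m⊥b r<m s₀
                  s[n]≡t = sums 1 ≤-refl 1≤k
              in  n , ≤-trans (s≤s z≤n) (<-≤-trans s₀<t t≤n) , n%m≡r , DigitSums≡⇒Niven b hb k sums t∣n
                  , (λ l 1≤l l≤k → trans (sums l 1≤l l≤k) (sym s[n]≡t))
                  , subst (s₀ ≤_) (sym s[n]≡t) (<⇒≤ s₀<t))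
  where
  m⊥b : Coprime m b
  m⊥b = gcd≡1⇒coprime gcd≡1
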